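{- Let $b(n,m)$ denote the number of Arndt compositions of $n$ whose last part equals $m$. Define $t_1(0)=1$, $t_1(1)=0$, $t_1(n)=F_{n-2}$ for $n\ge2$, and $t_2(0)=0$, $t_2(1)=1$, $t_2(n)=F_{n-1}$ for $n\ge 2$, where $F_n$ are the Fibonacci numbers ($F_0=0,F_1=1,F_n=F_{n-1}+F_{n-2}$). Then for all integers $n\ge 1$ and $m\ge 1$, $$b(n,m)=\begin{cases} t_1(n-m), & \text{if } m\leq n <2m,\\ t_1(n-m) + t_2(n-2m), & \text{if } 2m\leq n,\\ 0, & \text{otherwise.} \end{cases}$$
   Context: A composition of $n$ is a finite sequence $(\sigma_1,\dots,\sigma_\ell)$ of positive integers summing to $n$. An Arndt composition is one with $\sigma_{2i-1}>\sigma_{2i}$ for every positive integer $i$ with $2i\le\ell$. The last part of a nonempty composition is $\sigma_\ell$. -}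

module Defs where

open import Data.Nat using (ℕ; zero; suc; _+_; _∸_; _<ᵇ_; _≡ᵇ_)
open import Data.Bool using (Bool; true; false; _∧_)
open import Data.List using (List; []; _∷_; map; concatMap; length; filterᵇ; upTo)

F : ℕ → ℕ
F zero = 0
F (suc zero) = 1
F (suc (suc n)) = F (suc n) + F n

-- compositions of n: all lists of positive integers summing to n.
-- compsF fuel n enumerates them (first part k ranges over 1..n) given fuel ≥ n.
compsF : ℕ → ℕ → List (List ℕ)
compsF _ zero = [] ∷ []
compsF zero (suc n) = []
compsF (suc fuel) (suc n) =
  concatMap (λ i → map (suc i ∷_) (compsF fuel (suc n ∸ suc i))) (upTo (suc n))

compositions : ℕ → List (List ℕ)
compositions n = compsF n n

isArndt : List ℕ → Bool
isArndt [] = true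
isArndt (x ∷ []) = true
isArndt (x ∷ y ∷ rest) = (y <ᵇ x) ∧ isArndt rest

lastIs : ℕ → List ℕ → Bool
lastIs m [] = false
lastIs m (x ∷ []) = x ≡ᵇ m
lastIs m (x ∷ y ∷ rest) = lastIs m (y ∷ rest)

b : ℕ → ℕ → ℕ
b n m = length (filterᵇ (λ σ → isArndt σ ∧ lastIs m σ) (compositions n))

t₁ : ℕ → ℕ
t₁ zero = 1
t₁ (suc zero) = 0
t₁ (suc (suc k)) = F k

t₂ : ℕ → ℕ
t₂ zero = 0
t₂ (suc zero) = 1
t₂ (suc (suc k)) = F (suc k)

{-# OPTIONS --safe #-}
-- Removing the first descent (x , y), x > y, from an Arndt composition ending in m
-- leaves another one, unless the composition is just [m] or [x , m] with x > m.
-- Counting compositions by their first parts turns this into the renewal equation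
-- f = c + pairs ⋆ f for f s = b s m, where ⋆ is convolution of sequences, pairs s
-- counts the descents of size s and c counts the two exceptional compositions.
-- As pairs 0 = 0 the equation has a unique solution, and since pairs (s + 2) =
-- pairs s + 1 for s ≥ 1, t₁ solves it for c = δ₀; hence f = t₁ ⋆ c. With
-- c = δ_m + θ_m ⋆ δ_m (θ_m the indicator of s > m) this convolution is
-- t₁ (n - m) + Σ_{r < n - 2m} t₁ r = t₁ (n - m) + t₂ (n - 2m).
module Submission where

open import Data.Bool using (Bool; true; false; _∧_; T)
open import Data.Bool.Properties using (∧-zeroʳ; ∧-assoc)
open import Data.List using (List; []; _∷_; _++_; map; concatMap; filterᵇ; length; applyUpTo; upTo)
open import Data.List.Properties using (map-++; map-∘; map-cong; concatMap-cong; map-upTo)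
open import Data.Nat using (ℕ; zero; suc; _+_; _*_; _∸_; _≤_; _<_; z≤n; s≤s; _<ᵇ_; _≡ᵇ_)
open import Data.Nat.Induction using (<-rec)
open import Data.Nat.ListAction using (sum)
open import Data.Nat.ListAction.Properties using (sum-++)
open import Data.Nat.Properties
open import Algebra.Properties.CommutativeSemigroup +-commutativeSemigroup using (interchange)
open import Data.Product using (_×_; _,_)
open import Data.Unit using (tt)
open import Relation.Binary.PropositionalEquality
open ≡-Reasoning

open import Defs

private
  variable
    A B : Set

⟦_⟧ : Bool → ℕ
⟦ true ⟧ = 1
⟦ false ⟧ = 0

length-filterᵇ : (p : A → Bool) (xs : List A) →
  length (filterᵇ p xs) ≡ sum (map (λ x → ⟦ p x ⟧) xs)
length-filterᵇ p [] = refl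
length-filterᵇ p (x ∷ xs) with p x
... | true = cong suc (length-filterᵇ p xs)
... | false = length-filterᵇ p xs

sum-map-zero : (xs : List A) → sum (map (λ _ → 0) xs) ≡ 0
sum-map-zero [] = refl
sum-map-zero (x ∷ xs) = sum-map-zero xs

sum-map-+ : (f g : A → ℕ) (xs : List A) →
  sum (map (λ x → f x + g x) xs) ≡ sum (map f xs) + sum (map g xs)
sum-map-+ f g [] = refl
sum-map-+ f g (x ∷ xs) =
  trans (cong (f x + g x +_) (sum-map-+ f g xs)) (interchange (f x) (g x) _ _)

sum-map-*ˡ : (z : ℕ) (f : A → ℕ) (xs : List A) →
  sum (map (λ x → z * f x) xs) ≡ z * sum (map f xs)
sum-map-*ˡ z f [] = sym (*-zeroʳ z)
sum-map-*ˡ z f (x ∷ xs) =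
  trans (cong (z * f x +_) (sum-map-*ˡ z f xs)) (sym (*-distribˡ-+ z (f x) _))

sum-map-concatMap : (w : B → ℕ) (φ : A → List B) (xs : List A) →
  sum (map w (concatMap φ xs)) ≡ sum (map (λ x → sum (map w (φ x))) xs)
sum-map-concatMap w φ [] = refl
sum-map-concatMap w φ (x ∷ xs) = begin
  sum (map w (φ x ++ concatMap φ xs))
    ≡⟨ cong sum (map-++ w (φ x) _) ⟩
  sum (map w (φ x) ++ map w (concatMap φ xs))
    ≡⟨ sum-++ (map w (φ x)) _ ⟩
  sum (map w (φ x)) + sum (map w (concatMap φ xs))
    ≡⟨ cong (sum (map w (φ x)) +_) (sum-map-concatMap w φ xs) ⟩
  sum (map w (φ x)) + sum (map (λ x → sum (map w (φ x))) xs) ∎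

-- Σsplit f n = Σ_{a + b = n} f a b
Σsplit : (ℕ → ℕ → ℕ) → ℕ → ℕ
Σsplit f zero = f 0 0
Σsplit f (suc n) = f 0 (suc n) + Σsplit (λ a b → f (suc a) b) n

Σsplit-cong-≤ : ∀ n {f g : ℕ → ℕ → ℕ} → (∀ a b → b ≤ n → f a b ≡ g a b) →
  Σsplit f n ≡ Σsplit g n
Σsplit-cong-≤ zero eq = eq 0 0 z≤n
Σsplit-cong-≤ (suc n) eq = cong₂ _+_ (eq 0 (suc n) ≤-refl)
  (Σsplit-cong-≤ n (λ a b b≤n → eq (suc a) b (m≤n⇒m≤1+n b≤n)))

Σsplit-cong : ∀ n {f g : ℕ → ℕ → ℕ} → (∀ a b → f a b ≡ g a b) → Σsplit f n ≡ Σsplit g n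
Σsplit-cong n eq = Σsplit-cong-≤ n (λ a b _ → eq a b)

Σsplit-zero : ∀ n → Σsplit (λ _ _ → 0) n ≡ 0
Σsplit-zero zero = refl
Σsplit-zero (suc n) = Σsplit-zero n

Σsplit-+ : ∀ n (f g : ℕ → ℕ → ℕ) →
  Σsplit (λ a b → f a b + g a b) n ≡ Σsplit f n + Σsplit g n
Σsplit-+ zero f g = refl
Σsplit-+ (suc n) f g = trans (cong (f 0 (suc n) + g 0 (suc n) +_) (Σsplit-+ n _ _))
  (interchange (f 0 (suc n)) (g 0 (suc n)) _ _)

Σsplit-*ˡ : ∀ n (f : ℕ → ℕ → ℕ) z → Σsplit (λ a b → z * f a b) n ≡ z * Σsplit f n
Σsplit-*ˡ zero f z = refl
Σsplit-*ˡ (suc n) f z = trans (cong (z * f 0 (suc n) +_) (Σsplit-*ˡ n _ z))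
  (sym (*-distribˡ-+ z (f 0 (suc n)) _))

Σsplit-*ʳ : ∀ n (f : ℕ → ℕ → ℕ) z → Σsplit (λ a b → f a b * z) n ≡ Σsplit f n * z
Σsplit-*ʳ zero f z = refl
Σsplit-*ʳ (suc n) f z = trans (cong (f 0 (suc n) * z +_) (Σsplit-*ʳ n _ z))
  (sym (*-distribʳ-+ z (f 0 (suc n)) _))

Σsplit-sucʳ : ∀ n (f : ℕ → ℕ → ℕ) →
  Σsplit f (suc n) ≡ Σsplit (λ a b → f a (suc b)) n + f (suc n) 0
Σsplit-sucʳ zero f = refl
Σsplit-sucʳ (suc n) f = trans (cong (f 0 (suc (suc n)) +_) (Σsplit-sucʳ n (λ a b → f (suc a) b)))
  (sym (+-assoc (f 0 (suc (suc n))) _ _))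

Σsplit-last : ∀ n (f : ℕ → ℕ → ℕ) → (∀ a b → f a (suc b) ≡ 0) → Σsplit f n ≡ f n 0
Σsplit-last zero f _ = refl
Σsplit-last (suc n) f vanish = trans (Σsplit-sucʳ n f)
  (cong (_+ f (suc n) 0) (trans (Σsplit-cong n vanish) (Σsplit-zero n)))

Σsplit-swap : ∀ n (f : ℕ → ℕ → ℕ) → Σsplit f n ≡ Σsplit (λ a b → f b a) n
Σsplit-swap zero f = refl
Σsplit-swap (suc n) f = begin
  f 0 (suc n) + Σsplit (λ a b → f (suc a) b) n
    ≡⟨ cong (f 0 (suc n) +_) (Σsplit-swap n _) ⟩
  f 0 (suc n) + Σsplit (λ a b → f (suc b) a) n
    ≡⟨ +-comm (f 0 (suc n)) _ ⟩
  Σsplit (λ a b → f (suc b) a) n + f 0 (suc n)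
    ≡⟨ Σsplit-sucʳ n (λ a b → f b a) ⟨
  Σsplit (λ a b → f b a) (suc n) ∎

Σsplit-assoc : ∀ n (F : ℕ → ℕ → ℕ → ℕ) →
  Σsplit (λ a k → Σsplit (λ c r → F a c r) k) n
    ≡ Σsplit (λ e r → Σsplit (λ a c → F a c r) e) n
Σsplit-assoc zero F = refl
Σsplit-assoc (suc n) F = begin
  Σsplit (F 0) (suc n) + Σsplit (λ a k → Σsplit (F (suc a)) k) n
    ≡⟨ cong (Σsplit (F 0) (suc n) +_) (Σsplit-assoc n (λ a → F (suc a))) ⟩
  (F 0 0 (suc n) + Σsplit (λ e r → F 0 (suc e) r) n) + Σsplit later n
    ≡⟨ +-assoc (F 0 0 (suc n)) _ _ ⟩
  F 0 0 (suc n) + (Σsplit (λ e r → F 0 (suc e) r) n + Σsplit later n)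
    ≡⟨ cong (F 0 0 (suc n) +_) (Σsplit-+ n _ _) ⟨
  F 0 0 (suc n) + Σsplit (λ e r → Σsplit (λ a c → F a c r) (suc e)) n ∎
  where
  later : ℕ → ℕ → ℕ
  later e r = Σsplit (λ a c → F (suc a) c r) e

Σ< : (ℕ → ℕ) → ℕ → ℕ
Σ< f zero = 0
Σ< f (suc n) = Σ< f n + f n

Σsplit-const : ∀ n (f : ℕ → ℕ) → Σsplit (λ _ b → f b) n ≡ Σ< f (suc n)
Σsplit-const zero f = refl
Σsplit-const (suc n) f = trans (cong (f (suc n) +_) (Σsplit-const n f)) (+-comm (f (suc n)) _)

_⋆_ : (ℕ → ℕ) → (ℕ → ℕ) → ℕ → ℕ
(f ⋆ g) n = Σsplit (λ a b → f a * g b) n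

⋆-comm : ∀ f g → f ⋆ g ≗ g ⋆ f
⋆-comm f g n = trans (Σsplit-swap n _) (Σsplit-cong n (λ a b → *-comm (f b) (g a)))

⋆-assoc : ∀ f g h → (f ⋆ g) ⋆ h ≗ f ⋆ (g ⋆ h)
⋆-assoc f g h n = begin
  Σsplit (λ a b → Σsplit (λ x y → f x * g y) a * h b) n
    ≡⟨ Σsplit-cong n (λ a b → Σsplit-*ʳ a (λ x y → f x * g y) (h b)) ⟨
  Σsplit (λ a b → Σsplit (λ x y → f x * g y * h b) a) n
    ≡⟨ Σsplit-cong n (λ a b → Σsplit-cong a (λ x y → *-assoc (f x) (g y) (h b))) ⟩
  Σsplit (λ e b → Σsplit (λ x y → f x * (g y * h b)) e) n
    ≡⟨ Σsplit-assoc n (λ x y b → f x * (g y * h b)) ⟨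
  Σsplit (λ x k → Σsplit (λ y b → f x * (g y * h b)) k) n
    ≡⟨ Σsplit-cong n (λ x k → Σsplit-*ˡ k (λ y b → g y * h b) (f x)) ⟩
  Σsplit (λ x k → f x * Σsplit (λ y b → g y * h b) k) n ∎

⋆-distribˡ-+ : ∀ f g h n → (f ⋆ (λ k → g k + h k)) n ≡ (f ⋆ g) n + (f ⋆ h) n
⋆-distribˡ-+ f g h n =
  trans (Σsplit-cong n (λ a b → *-distribˡ-+ (f a) (g b) (h b))) (Σsplit-+ n _ _)

⋆-interior : ∀ {f g} n → f 0 ≡ 0 → g 0 ≡ 0 →
  (f ⋆ g) (suc (suc n)) ≡ Σsplit (λ a b → f (suc a) * g (suc b)) n
⋆-interior {f} {g} n f0 g0 = begin
  f 0 * g (suc (suc n)) + Σsplit (λ a b → f (suc a) * g b) (suc n)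
    ≡⟨ cong₂ _+_ (cong (_* g (suc (suc n))) f0) (Σsplit-sucʳ n (λ a b → f (suc a) * g b)) ⟩
  inner + f (suc (suc n)) * g 0
    ≡⟨ cong (inner +_) (trans (cong (f (suc (suc n)) *_) g0) (*-zeroʳ (f (suc (suc n))))) ⟩
  inner + 0
    ≡⟨ +-identityʳ inner ⟩
  inner ∎
  where
  inner : ℕ
  inner = Σsplit (λ a b → f (suc a) * g (suc b)) n

δ : ℕ → ℕ → ℕ
δ m s = ⟦ s ≡ᵇ m ⟧

θ : ℕ → ℕ → ℕ
θ k s = ⟦ k <ᵇ s ⟧

⋆-identityˡ : ∀ f → δ 0 ⋆ f ≗ f
⋆-identityˡ f zero = +-identityʳ (f 0)
⋆-identityˡ f (suc n) =
  trans (cong₂ _+_ (+-identityʳ (f (suc n))) (Σsplit-zero n)) (+-identityʳ (f (suc n)))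

δ-⋆ : ∀ {m n} f → m ≤ n → (δ m ⋆ f) n ≡ f (n ∸ m)
δ-⋆ f z≤n = ⋆-identityˡ f _
δ-⋆ f (s≤s m≤n) = δ-⋆ f m≤n

δ-⋆-< : ∀ {m n} f → n < m → (δ m ⋆ f) n ≡ 0
δ-⋆-< {n = zero} f (s≤s _) = refl
δ-⋆-< {n = suc n} f (s≤s n<m) = δ-⋆-< f n<m

θ-⋆ : ∀ k f n → (θ k ⋆ f) n ≡ Σ< f (n ∸ k)
θ-⋆ zero f zero = refl
θ-⋆ zero f (suc n) = trans (Σsplit-cong n (λ _ b → +-identityʳ (f b))) (Σsplit-const n f)
θ-⋆ (suc k) f zero = refl
θ-⋆ (suc k) f (suc n) = θ-⋆ k f n

-- pairs s = ⌊(s ∸ 1) / 2⌋ is the number of descents (x , y), x > y ≥ 1, with x + y = s.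
pairs : ℕ → ℕ
pairs zero = 0
pairs (suc zero) = 0
pairs (suc (suc zero)) = 0
pairs (suc (suc (suc s))) = suc (pairs (suc s))

-- i and j stand for x ∸ 1 and y ∸ 1.
pairs-count : ∀ e → Σsplit (λ i j → ⟦ j <ᵇ i ⟧) e ≡ pairs (suc (suc e))
pairs-count zero = refl
pairs-count (suc zero) = refl
pairs-count (suc (suc e)) =
  trans (Σsplit-sucʳ e (λ a b → ⟦ b <ᵇ suc a ⟧)) (trans (+-comm _ 1) (cong suc (pairs-count e)))

-- The first step of the proof is definitional: pairs vanishes at 0, 1 and 2, and
-- pairs (3 + a) = suc (pairs (1 + a)).
pairs-⋆-suc³ : ∀ f n → (pairs ⋆ f) (suc (suc (suc n))) ≡ Σ< f (suc n) + (pairs ⋆ f) (suc n)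
pairs-⋆-suc³ f n = begin
  Σsplit (λ a b → f b + pairs (suc a) * f b) n
    ≡⟨ Σsplit-+ n (λ _ b → f b) (λ a b → pairs (suc a) * f b) ⟩
  Σsplit (λ _ b → f b) n + (pairs ⋆ f) (suc n)
    ≡⟨ cong (_+ (pairs ⋆ f) (suc n)) (Σsplit-const n f) ⟩
  Σ< f (suc n) + (pairs ⋆ f) (suc n) ∎

SolvesRenewal : (ℕ → ℕ) → (ℕ → ℕ) → Set
SolvesRenewal c f = ∀ n → f n ≡ c n + (pairs ⋆ f) n

-- As pairs 0 ≡ 0, (pairs ⋆ f) n only involves the values f r with r < n.
pairs-⋆-local : ∀ {f g} n → (∀ {r} → r < n → f r ≡ g r) → (pairs ⋆ f) n ≡ (pairs ⋆ g) n
pairs-⋆-local zero _ = refl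
pairs-⋆-local (suc n) f≡g =
  Σsplit-cong-≤ n (λ a b b≤n → cong (pairs (suc a) *_) (f≡g (s≤s b≤n)))

renewal-unique : ∀ {c f g} → SolvesRenewal c f → SolvesRenewal c g → f ≗ g
renewal-unique {c} {f} {g} f-sol g-sol = <-rec _ step
  where
  step : ∀ n → (∀ {r} → r < n → f r ≡ g r) → f n ≡ g n
  step n ih = begin
    f n                  ≡⟨ f-sol n ⟩
    c n + (pairs ⋆ f) n  ≡⟨ cong (c n +_) (pairs-⋆-local n ih) ⟩
    c n + (pairs ⋆ g) n  ≡⟨ g-sol n ⟨
    g n                  ∎

⋆-renewal : ∀ {e} c → SolvesRenewal (δ 0) e → SolvesRenewal c (e ⋆ c)
⋆-renewal {e} c e-sol n = begin
  (e ⋆ c) n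
    ≡⟨ Σsplit-cong n (λ a b → trans (cong (_* c b) (e-sol a)) (*-distribʳ-+ (c b) (δ 0 a) _)) ⟩
  Σsplit (λ a b → δ 0 a * c b + (pairs ⋆ e) a * c b) n
    ≡⟨ Σsplit-+ n _ _ ⟩
  (δ 0 ⋆ c) n + ((pairs ⋆ e) ⋆ c) n
    ≡⟨ cong₂ _+_ (⋆-identityˡ c n) (⋆-assoc pairs e c n) ⟩
  c n + (pairs ⋆ (e ⋆ c)) n ∎

t₂-suc : ∀ n → t₂ (suc n) + t₁ (suc n) ≡ t₂ (suc (suc n))
t₂-suc zero = refl
t₂-suc (suc n) = refl

Σ<-t₁ : ∀ n → Σ< t₁ n ≡ t₂ n
Σ<-t₁ zero = refl
Σ<-t₁ (suc zero) = refl
Σ<-t₁ (suc (suc n)) = trans (cong (_+ t₁ (suc n)) (Σ<-t₁ (suc n))) (t₂-suc n)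

t₁-renewal : SolvesRenewal (δ 0) t₁
t₁-renewal zero = refl
t₁-renewal (suc zero) = refl
t₁-renewal (suc (suc zero)) = refl
t₁-renewal (suc (suc (suc n))) = sym (begin
  (pairs ⋆ t₁) (suc (suc (suc n)))
    ≡⟨ pairs-⋆-suc³ t₁ n ⟩
  Σ< t₁ (suc n) + (pairs ⋆ t₁) (suc n)
    ≡⟨ cong₂ _+_ (Σ<-t₁ (suc n)) (sym (t₁-renewal (suc n))) ⟩
  t₂ (suc n) + t₁ (suc n)
    ≡⟨ t₂-suc n ⟩
  t₂ (suc (suc n)) ∎)

Σcomp : (List ℕ → ℕ) → ℕ → ℕ
Σcomp w n = sum (map w (compositions n))

Σcomp-cong : ∀ {v w} → v ≗ w → Σcomp v ≗ Σcomp w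
Σcomp-cong v≗w n = cong sum (map-cong v≗w (compositions n))

Σcomp-+ : ∀ v w n → Σcomp (λ σ → v σ + w σ) n ≡ Σcomp v n + Σcomp w n
Σcomp-+ v w n = sum-map-+ v w (compositions n)

compsF-fuel : ∀ f g n → n ≤ f → n ≤ g → compsF f n ≡ compsF g n
compsF-fuel f g zero _ _ = refl
compsF-fuel (suc f) (suc g) (suc n) (s≤s n≤f) (s≤s n≤g) = concatMap-cong
  (λ i → cong (map (suc i ∷_))
    (compsF-fuel f g (n ∸ i) (≤-trans (m∸n≤m n i) n≤f) (≤-trans (m∸n≤m n i) n≤g)))
  (upTo (suc n))

sum-applyUpTo : ∀ n (h : ℕ → ℕ → ℕ) →
  sum (applyUpTo (λ i → h i (n ∸ i)) (suc n)) ≡ Σsplit h n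
sum-applyUpTo zero h = +-identityʳ (h 0 0)
sum-applyUpTo (suc n) h = cong (h 0 (suc n) +_) (sum-applyUpTo n (λ a b → h (suc a) b))

Σcomp-suc : ∀ w n → Σcomp w (suc n) ≡ Σsplit (λ i k → Σcomp (λ σ → w (suc i ∷ σ)) k) n
Σcomp-suc w n = begin
  sum (map w (concatMap firstPart (upTo (suc n))))
    ≡⟨ sum-map-concatMap w firstPart (upTo (suc n)) ⟩
  sum (map (λ i → sum (map w (firstPart i))) (upTo (suc n)))
    ≡⟨ cong sum (map-cong firstPart-sum (upTo (suc n))) ⟩
  sum (map (λ i → Σcomp (λ σ → w (suc i ∷ σ)) (n ∸ i)) (upTo (suc n)))
    ≡⟨ cong sum (map-upTo _ (suc n)) ⟩
  sum (applyUpTo (λ i → Σcomp (λ σ → w (suc i ∷ σ)) (n ∸ i)) (suc n))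
    ≡⟨ sum-applyUpTo n _ ⟩
  Σsplit (λ i k → Σcomp (λ σ → w (suc i ∷ σ)) k) n ∎
  where
  firstPart : ℕ → List (List ℕ)
  firstPart i = map (suc i ∷_) (compsF n (n ∸ i))

  firstPart-sum : ∀ i → sum (map w (firstPart i)) ≡ Σcomp (λ σ → w (suc i ∷ σ)) (n ∸ i)
  firstPart-sum i = cong sum (trans (sym (map-∘ (compsF n (n ∸ i))))
    (cong (map _) (compsF-fuel n (n ∸ i) (n ∸ i) (m∸n≤m n i) ≤-refl)))

single : (ℕ → ℕ) → List ℕ → ℕ
single f (x ∷ []) = f x
single f _ = 0

pair : (ℕ → ℕ) → (ℕ → ℕ) → List ℕ → ℕ
pair f g [] = 0
pair f g (x ∷ σ) = single (λ y → f x * g y) σ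

descentThen : (List ℕ → ℕ) → List ℕ → ℕ
descentThen w (x ∷ y ∷ σ) = ⟦ y <ᵇ x ⟧ * w σ
descentThen w _ = 0

Σcomp-single-suc : ∀ f n → Σcomp (single f) (suc n) ≡ f (suc n)
Σcomp-single-suc f n = begin
  Σcomp (single f) (suc n)
    ≡⟨ Σcomp-suc (single f) n ⟩
  Σsplit (λ i k → Σcomp (λ σ → single f (suc i ∷ σ)) k) n
    ≡⟨ Σsplit-last n _ longer ⟩
  f (suc n) + 0
    ≡⟨ +-identityʳ _ ⟩
  f (suc n) ∎
  where
  longer : ∀ i k → Σcomp (λ σ → single f (suc i ∷ σ)) (suc k) ≡ 0
  longer i k = trans (Σcomp-suc _ k)
    (trans (Σsplit-cong k (λ _ r → sum-map-zero (compositions r))) (Σsplit-zero k))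

Σcomp-single : ∀ f → f 0 ≡ 0 → Σcomp (single f) ≗ f
Σcomp-single f f0 zero = sym f0
Σcomp-single f f0 (suc n) = Σcomp-single-suc f n

Σcomp-pair : ∀ f g → f 0 ≡ 0 → g 0 ≡ 0 → Σcomp (pair f g) ≗ f ⋆ g
Σcomp-pair f g f0 g0 zero = sym (cong (_* g 0) f0)
Σcomp-pair f g f0 g0 (suc zero) =
  sym (cong₂ _+_ (cong (_* g 1) f0) (trans (cong (f 1 *_) g0) (*-zeroʳ (f 1))))
Σcomp-pair f g f0 g0 (suc (suc n)) = begin
  Σcomp (pair f g) (suc (suc n))
    ≡⟨ Σcomp-suc (pair f g) (suc n) ⟩
  Σsplit (λ i k → Σcomp (λ σ → pair f g (suc i ∷ σ)) k) (suc n)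
    ≡⟨ Σsplit-sucʳ n (λ i k → Σcomp (λ σ → pair f g (suc i ∷ σ)) k) ⟩
  Σsplit (λ i k → Σcomp (single (λ y → f (suc i) * g y)) (suc k)) n + 0
    ≡⟨ +-identityʳ _ ⟩
  Σsplit (λ i k → Σcomp (single (λ y → f (suc i) * g y)) (suc k)) n
    ≡⟨ Σsplit-cong n (λ i k → Σcomp-single-suc _ k) ⟩
  Σsplit (λ i k → f (suc i) * g (suc k)) n
    ≡⟨ ⋆-interior {f} {g} n f0 g0 ⟨
  (f ⋆ g) (suc (suc n)) ∎

Σcomp-descentThen : ∀ w → Σcomp (descentThen w) ≗ pairs ⋆ Σcomp w
Σcomp-descentThen w zero = refl
Σcomp-descentThen w (suc zero) = refl
Σcomp-descentThen w (suc (suc n)) = begin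
  Σcomp (descentThen w) (suc (suc n))
    ≡⟨ Σcomp-suc (descentThen w) (suc n) ⟩
  Σsplit (λ i k → Σcomp (λ σ → descentThen w (suc i ∷ σ)) k) (suc n)
    ≡⟨ Σsplit-sucʳ n (λ i k → Σcomp (λ σ → descentThen w (suc i ∷ σ)) k) ⟩
  Σsplit (λ i k → Σcomp (λ σ → descentThen w (suc i ∷ σ)) (suc k)) n + 0
    ≡⟨ +-identityʳ _ ⟩
  Σsplit (λ i k → Σcomp (λ σ → descentThen w (suc i ∷ σ)) (suc k)) n
    ≡⟨ Σsplit-cong n second-part ⟩
  Σsplit (λ i k → Σsplit (λ j r → ⟦ j <ᵇ i ⟧ * Σcomp w r) k) n
    ≡⟨ Σsplit-assoc n _ ⟩
  Σsplit (λ e r → Σsplit (λ i j → ⟦ j <ᵇ i ⟧ * Σcomp w r) e) n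
    ≡⟨ Σsplit-cong n (λ e r →
         trans (Σsplit-*ʳ e _ (Σcomp w r)) (cong (_* Σcomp w r) (pairs-count e))) ⟩
  (pairs ⋆ Σcomp w) (suc (suc n)) ∎
  where
  second-part : ∀ i k → Σcomp (λ σ → descentThen w (suc i ∷ σ)) (suc k)
                      ≡ Σsplit (λ j r → ⟦ j <ᵇ i ⟧ * Σcomp w r) k
  second-part i k = trans (Σcomp-suc _ k)
    (Σsplit-cong k (λ j r → sum-map-*ˡ ⟦ j <ᵇ i ⟧ w (compositions r)))

arndtLast : ℕ → List ℕ → ℕ
arndtLast m σ = ⟦ isArndt σ ∧ lastIs m σ ⟧

⟦∧⟧ : ∀ a c → ⟦ a ∧ c ⟧ ≡ ⟦ a ⟧ * ⟦ c ⟧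
⟦∧⟧ true c = sym (+-identityʳ ⟦ c ⟧)
⟦∧⟧ false c = refl

arndtLast-split : ∀ m σ →
  arndtLast m σ ≡ single (δ m) σ + pair (θ m) (δ m) σ + descentThen (arndtLast m) σ
arndtLast-split m [] = refl
arndtLast-split m (x ∷ []) = sym (trans (+-identityʳ _) (+-identityʳ _))
arndtLast-split m (x ∷ y ∷ []) with y ≡ᵇ m in y≡ᵇm
... | false = trans (cong ⟦_⟧ (∧-zeroʳ _))
  (sym (cong₂ _+_ (*-zeroʳ ⟦ m <ᵇ x ⟧) (*-zeroʳ ⟦ y <ᵇ x ⟧)))
... | true rewrite ≡ᵇ⇒≡ y m (subst T (sym y≡ᵇm) tt) with m <ᵇ x
...   | true = refl
...   | false = refl
arndtLast-split m (x ∷ y ∷ z ∷ σ) =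
  trans (cong ⟦_⟧ (∧-assoc (y <ᵇ x) _ _)) (⟦∧⟧ (y <ᵇ x) (arndt∧last (z ∷ σ)))
  where
  arndt∧last : List ℕ → Bool
  arndt∧last τ = isArndt τ ∧ lastIs m τ

lastBlock : ℕ → ℕ → ℕ
lastBlock m s = δ m s + (θ m ⋆ δ m) s

arndtLast-renewal : ∀ m → SolvesRenewal (lastBlock (suc m)) (Σcomp (arndtLast (suc m)))
arndtLast-renewal m n = begin
  Σcomp (arndtLast M) n
    ≡⟨ Σcomp-cong (arndtLast-split M) n ⟩
  Σcomp (λ σ → final σ + descentThen (arndtLast M) σ) n
    ≡⟨ Σcomp-+ final (descentThen (arndtLast M)) n ⟩
  Σcomp final n + Σcomp (descentThen (arndtLast M)) n
    ≡⟨ cong₂ _+_ final-count (Σcomp-descentThen (arndtLast M) n) ⟩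
  lastBlock M n + (pairs ⋆ Σcomp (arndtLast M)) n ∎
  where
  M : ℕ
  M = suc m

  final : List ℕ → ℕ
  final σ = single (δ M) σ + pair (θ M) (δ M) σ

  final-count : Σcomp final n ≡ lastBlock M n
  final-count = trans (Σcomp-+ (single (δ M)) (pair (θ M) (δ M)) n)
    (cong₂ _+_ (Σcomp-single (δ M) refl n) (Σcomp-pair (θ M) (δ M) refl refl n))

b-as-δ⋆ : ∀ m n → b n (suc m) ≡ (δ (suc m) ⋆ t₁) n + (δ (suc m) ⋆ (t₁ ⋆ θ (suc m))) n
b-as-δ⋆ m n = begin
  b n M
    ≡⟨ length-filterᵇ _ (compositions n) ⟩
  Σcomp (arndtLast M) n
    ≡⟨ renewal-unique (arndtLast-renewal m) (⋆-renewal (lastBlock M) t₁-renewal) n ⟩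
  (t₁ ⋆ lastBlock M) n
    ≡⟨ ⋆-distribˡ-+ t₁ (δ M) (θ M ⋆ δ M) n ⟩
  (t₁ ⋆ δ M) n + (t₁ ⋆ (θ M ⋆ δ M)) n
    ≡⟨ cong₂ _+_ (⋆-comm t₁ (δ M) n)
                 (trans (sym (⋆-assoc t₁ (θ M) (δ M) n)) (⋆-comm (t₁ ⋆ θ M) (δ M) n)) ⟩
  (δ M ⋆ t₁) n + (δ M ⋆ (t₁ ⋆ θ M)) n ∎
  where
  M : ℕ
  M = suc m

b-< : ∀ m n → n < suc m → b n (suc m) ≡ 0
b-< m n n<m = trans (b-as-δ⋆ m n) (cong₂ _+_ (δ-⋆-< t₁ n<m) (δ-⋆-< _ n<m))

b-≥ : ∀ m n → suc m ≤ n → b n (suc m) ≡ t₁ (n ∸ suc m) + t₂ (n ∸ 2 * suc m)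
b-≥ m n m≤n = trans (b-as-δ⋆ m n) (cong₂ _+_ (δ-⋆ t₁ m≤n) (begin
  (δ M ⋆ (t₁ ⋆ θ M)) n  ≡⟨ δ-⋆ _ m≤n ⟩
  (t₁ ⋆ θ M) (n ∸ M)    ≡⟨ ⋆-comm t₁ (θ M) (n ∸ M) ⟩
  (θ M ⋆ t₁) (n ∸ M)    ≡⟨ θ-⋆ M t₁ (n ∸ M) ⟩
  Σ< t₁ (n ∸ M ∸ M)     ≡⟨ Σ<-t₁ (n ∸ M ∸ M) ⟩
  t₂ (n ∸ M ∸ M)        ≡⟨ cong t₂ (∸-+-assoc n M M) ⟩
  t₂ (n ∸ (M + M))      ≡⟨ cong (λ k → t₂ (n ∸ (M + k))) (+-identityʳ M) ⟨
  t₂ (n ∸ 2 * M)        ∎))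
  where
  M : ℕ
  M = suc m

theorem3p2 : ∀ (n m : ℕ) → 1 ≤ n → 1 ≤ m →
    (m ≤ n → n < 2 * m → b n m ≡ t₁ (n ∸ m)) × (2 * m ≤ n → b n m ≡ t₁ (n ∸ m) + t₂ (n ∸ 2 * m)) × (n < m → b n m ≡ 0)
theorem3p2 n (suc m) _ _ = below-2m , from-2m , b-< m n
  where
  below-2m : suc m ≤ n → n < 2 * suc m → b n (suc m) ≡ t₁ (n ∸ suc m)
  below-2m m≤n n<2m = begin
    b n (suc m)
      ≡⟨ b-≥ m n m≤n ⟩
    t₁ (n ∸ suc m) + t₂ (n ∸ 2 * suc m)
      ≡⟨ cong (λ k → t₁ (n ∸ suc m) + t₂ k) (m≤n⇒m∸n≡0 (<⇒≤ n<2m)) ⟩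
    t₁ (n ∸ suc m) + 0
      ≡⟨ +-identityʳ _ ⟩
    t₁ (n ∸ suc m) ∎

  from-2m : 2 * suc m ≤ n → b n (suc m) ≡ t₁ (n ∸ suc m) + t₂ (n ∸ 2 * suc m)
  from-2m 2m≤n = b-≥ m n (≤-trans (m≤m+n (suc m) _) 2m≤n)
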